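{- Let $G$ and $H$ be signed graphs with $n$ and $m$ vertices respectively. Then $$f_{G\circ H}(\lambda)=\big(f_{H}(\lambda)\big)^n\cdot f_{G}\big(\lambda-\chi_{H}(\lambda)\big).$$
   Context: A signed graph $G=(V,E,\sigma)$ is a finite simple graph with signature $\sigma:E\to\{+1,-1\}$, considered with its canonical marking $\mu(v)=\prod_{e\ni v}\sigma(e)$ (product over incident edges; empty product $=+1$); $\mu[V]$ is the column vector of markings. $A(G)$ is the signed adjacency matrix, $f_G(\lambda)=\det(\lambda I-A(G))$, and $\chi_H(\lambda)=\mu[V]^T(\lambda I-A(H))^{ -1}\mu[V]$ is the signed coronal. The corona product $G\circ H$ of $G$ (vertices $v_1,\dots,v_n$, marking $\mu$) and $H$ (marking $\mu'$) is obtained by taking $G$ and $n$ disjoint copies $H^{(1)},\dots,H^{(n)}$ of $H$ and, for each $l$, joining $v_l$ to every vertex $w$ of $H^{(l)}$ by an edge of sign $\mu(v_l)\mu'(w)$. -}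

module Defs where

open import Data.Nat using (ℕ; zero; suc)
import Data.Nat as ℕ
open import Data.Fin using (Fin; zero; suc; toℕ; punchIn; splitAt; remQuot; _≟_)
open import Data.Sum using (_⊎_; inj₁; inj₂)
open import Data.Product using (_×_; _,_)
open import Data.Maybe using (Maybe; just; nothing)
open import Data.Sign using (Sign) renaming (_*_ to _*ₛ_)
import Data.Sign as Sign
open import Data.Rational using (ℚ; 0ℚ; 1ℚ; _+_; _*_; _-_; -_; 1/_; ≢-nonZero)
open import Relation.Binary.PropositionalEquality using (_≡_; _≢_; refl; sym; trans)
open import Relation.Nullary using (yes; no)

record SignedGraph (n : ℕ) : Set where
  field
    edge   : Fin n → Fin n → Maybe Sign
    edge-sym    : ∀ i j → edge i j ≡ edge j i
    edge-irrefl : ∀ i → edge i i ≡ nothing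
open SignedGraph public

sumFin : ∀ {n} → (Fin n → ℚ) → ℚ
sumFin {zero}  f = 0ℚ
sumFin {suc n} f = f zero + sumFin (λ i → f (suc i))

prodSign : ∀ {n} → (Fin n → Sign) → Sign
prodSign {zero}  f = Sign.+
prodSign {suc n} f = f zero *ₛ prodSign (λ i → f (suc i))

_^_ : ℚ → ℕ → ℚ
x ^ zero  = 1ℚ
x ^ suc k = x * (x ^ k)

-- Canonical marking: product of the signs of the incident edges

signOrPlus : Maybe Sign → Sign
signOrPlus nothing  = Sign.+
signOrPlus (just s) = s

marking : ∀ {n} → SignedGraph n → Fin n → Sign
marking G v = prodSign (λ w → signOrPlus (edge G v w))

signToℚ : Sign → ℚ
signToℚ Sign.+ = 1ℚ
signToℚ Sign.- = - 1ℚ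

entry : Maybe Sign → ℚ
entry nothing  = 0ℚ
entry (just s) = signToℚ s

Matrix : ℕ → Set
Matrix n = Fin n → Fin n → ℚ

adjMatrix : ∀ {n} → SignedGraph n → Matrix n
adjMatrix G i j = entry (edge G i j)

minusOnePow : ℕ → ℚ
minusOnePow zero    = 1ℚ
minusOnePow (suc k) = - minusOnePow k

minor : ∀ {n} → Matrix (suc n) → Fin (suc n) → Fin (suc n) → Matrix n
minor M r c i k = M (punchIn r i) (punchIn c k)

det : ∀ {n} → Matrix n → ℚ
det {zero}  M = 1ℚ
det {suc n} M = sumFin (λ j → minusOnePow (toℕ j) * (M zero j * det (minor M zero j)))

adjugate : ∀ {n} → Matrix n → Matrix n
adjugate {zero}  M i j = 0ℚ
adjugate {suc n} M i j = minusOnePow (toℕ i ℕ.+ toℕ j) * det (minor M j i)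

inverse : ∀ {n} (M : Matrix n) → det M ≢ 0ℚ → Matrix n
inverse M nz i j = (1/ det M) {{≢-nonZero nz}} * adjugate M i j

idMinus : ∀ {n} → ℚ → Matrix n → Matrix n
idMinus x A i j with i ≟ j
... | yes _ = x - A i j
... | no  _ = - A i j

charPoly : ∀ {n} → SignedGraph n → ℚ → ℚ
charPoly G x = det (idMinus x (adjMatrix G))

coronal : ∀ {m} (H : SignedGraph m) (x : ℚ) → charPoly H x ≢ 0ℚ → ℚ
coronal H x nz =
  sumFin (λ i → sumFin (λ j →
    signToℚ (marking H i) * (inverse (idMinus x (adjMatrix H)) nz i j * signToℚ (marking H j))))

-- Corona product G ∘ H. Vertex set Fin (n + n * m):
--   index via splitAt n: inj₁ l  = vertex v_l of G,
--                        inj₂ p, remQuot m p = (l , w) = vertex w of copy H^(l).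

Vtx : ℕ → ℕ → Set
Vtx n m = Fin n ⊎ (Fin n × Fin m)

spoke : ∀ {n m} → SignedGraph n → SignedGraph m → Fin n → Fin n → Fin m → Maybe Sign
spoke G H l k w with l ≟ k
... | yes _ = just (marking G l *ₛ marking H w)
... | no  _ = nothing

coronaEdge' : ∀ {n m} → SignedGraph n → SignedGraph m → Vtx n m → Vtx n m → Maybe Sign
coronaEdge' G H (inj₁ i) (inj₁ j) = edge G i j
coronaEdge' G H (inj₁ l) (inj₂ (k , w)) = spoke G H l k w
coronaEdge' G H (inj₂ (k , w)) (inj₁ l) = spoke G H l k w
coronaEdge' G H (inj₂ (k , w)) (inj₂ (k' , w')) with k ≟ k'
... | yes _ = edge H w w'
... | no  _ = nothing

classify : ∀ n m → Fin (n ℕ.+ n ℕ.* m) → Vtx n m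
classify n m v with splitAt n v
... | inj₁ i = inj₁ i
... | inj₂ p = inj₂ (remQuot m p)

private
  sym' : ∀ {n m} (G : SignedGraph n) (H : SignedGraph m) (a b : Vtx n m) →
         coronaEdge' G H a b ≡ coronaEdge' G H b a
  sym' G H (inj₁ i) (inj₁ j) = edge-sym G i j
  sym' G H (inj₁ l) (inj₂ (k , w)) = refl
  sym' G H (inj₂ (k , w)) (inj₁ l) = refl
  sym' G H (inj₂ (k , w)) (inj₂ (k' , w')) with k ≟ k' | k' ≟ k
  ... | yes _ | yes _ = edge-sym H w w'
  ... | yes p | no ¬q = Data.Empty.⊥-elim (¬q (sym p))
    where import Data.Empty
  ... | no ¬p | yes q = Data.Empty.⊥-elim (¬p (sym q))
    where import Data.Empty
  ... | no _  | no _  = refl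

  irr' : ∀ {n m} (G : SignedGraph n) (H : SignedGraph m) (a : Vtx n m) →
         coronaEdge' G H a a ≡ nothing
  irr' G H (inj₁ i) = edge-irrefl G i
  irr' G H (inj₂ (k , w)) with k ≟ k
  ... | yes _ = edge-irrefl H w
  ... | no ¬p = Data.Empty.⊥-elim (¬p refl)
    where import Data.Empty

corona : ∀ {n m} → SignedGraph n → SignedGraph m → SignedGraph (n ℕ.+ n ℕ.* m)
corona {n} {m} G H = record
  { edge        = λ u v → coronaEdge' G H (classify n m u) (classify n m v)
  ; edge-sym    = λ u v → sym' G H (classify n m u) (classify n m v)
  ; edge-irrefl = λ u → irr' G H (classify n m u)
  }

{-# OPTIONS --safe #-}
module Submission where

-- List the vertices of G ∘ H as v₁ … vₙ followed by the copies H⁽¹⁾ … H⁽ⁿ⁾. Then λI − A(G ∘ H) is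
-- [[λI − A(G), −B], [−Bᵀ, diag(T, …, T)]] with T = λI − A(H), where row l of B is μ(v_l) μ′ᵀ on the
-- columns of H⁽ˡ⁾. Put b = T⁻¹μ′ and add μ(v_l) b_w times the row of w ∈ H⁽ˡ⁾ to the row of v_l.
-- As T is symmetric, bᵀT = μ′ᵀ, so this clears −B, and it subtracts μ(v_l)² μ′ᵀb = χ_H(λ) from the
-- diagonal entry of v_l. The result is block lower triangular with diagonal blocks
-- (λ − χ_H(λ))I − A(G) and n copies of T.
--
-- Since det is the expansion along the first row, the row operations rest on one computation:
-- expanding along the first two rows shows that swapping them negates the determinant.

open import Defs
open import Data.Empty using (⊥-elim)
open import Data.Fin using (Fin; zero; suc; toℕ; punchIn; inject₁; fromℕ<; _↑ˡ_; _↑ʳ_; splitAt; remQuot; combine)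
import Data.Fin as Fin
import Data.Fin.Properties as Fin
open import Data.Maybe using (nothing)
open import Data.Nat using (ℕ; zero; suc)
import Data.Nat as ℕ
import Data.Nat.Properties as ℕ
open import Data.Product using (_×_; _,_; map₁)
open import Data.Rational using (ℚ; 0ℚ; 1ℚ; ½; _+_; _*_; _-_; -_; 1/_; ≢-nonZero)
open import Data.Rational.Properties
  using (+-identityˡ; +-identityʳ; *-identityˡ; *-identityʳ; *-zeroˡ; *-zeroʳ; +-comm; +-assoc; *-comm; *-assoc)
import Data.Rational.Properties as ℚ
open import Data.Sign using () renaming (_*_ to _*ₛ_)
import Data.Sign as Sign
open import Data.Sum using (_⊎_; inj₁; inj₂)
open import Function using (_∘_)
open import Algebra.Properties.Group ℚ.+-0-group
  using () renaming (∙-cancelʳ to +-cancelʳ; ⁻¹-involutive to neg-involutive)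
open import Level using (0ℓ)
open import Relation.Binary.Definitions using (tri<; tri≈; tri>)
open import Relation.Binary.PropositionalEquality
open import Relation.Nullary using (¬_; Dec; yes; no)
open import Relation.Nullary.Decidable using (dec⇒maybe)
open import Tactic.RingSolver using (solve-∀)
open import Tactic.RingSolver.Core.AlmostCommutativeRing using (AlmostCommutativeRing; fromCommutativeRing)

ℚ-ring : AlmostCommutativeRing 0ℓ 0ℓ
ℚ-ring = fromCommutativeRing ℚ.+-*-commutativeRing (λ x → dec⇒maybe (0ℚ ℚ.≟ x))

sumFin-cong : ∀ {n} {f g : Fin n → ℚ} → (∀ i → f i ≡ g i) → sumFin f ≡ sumFin g
sumFin-cong {zero}  f≗g = refl
sumFin-cong {suc n} f≗g = cong₂ _+_ (f≗g zero) (sumFin-cong (f≗g ∘ suc))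

sumFin-zero : ∀ {n} (f : Fin n → ℚ) → (∀ i → f i ≡ 0ℚ) → sumFin f ≡ 0ℚ
sumFin-zero {zero}  f f≗0 = refl
sumFin-zero {suc n} f f≗0 = cong₂ _+_ (f≗0 zero) (sumFin-zero (f ∘ suc) (f≗0 ∘ suc))

sumFin-+ : ∀ {n} (f g : Fin n → ℚ) → sumFin (λ i → f i + g i) ≡ sumFin f + sumFin g
sumFin-+ {zero}  f g = refl
sumFin-+ {suc n} f g = trans (cong (f zero + g zero +_) (sumFin-+ (f ∘ suc) (g ∘ suc)))
                             (interchange (f zero) (g zero) _ _)
  where
  interchange : ∀ a b c d → a + b + (c + d) ≡ a + c + (b + d)
  interchange = solve-∀ ℚ-ring

sumFin-neg : ∀ {n} (f : Fin n → ℚ) → sumFin (λ i → - f i) ≡ - sumFin f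
sumFin-neg {zero}  f = refl
sumFin-neg {suc n} f = trans (cong (- f zero +_) (sumFin-neg (f ∘ suc))) (sym (ℚ.neg-distrib-+ (f zero) _))

sumFin-*ˡ : ∀ {n} (c : ℚ) (f : Fin n → ℚ) → sumFin (λ i → c * f i) ≡ c * sumFin f
sumFin-*ˡ {zero}  c f = sym (*-zeroʳ c)
sumFin-*ˡ {suc n} c f = trans (cong (c * f zero +_) (sumFin-*ˡ c (f ∘ suc)))
                              (sym (ℚ.*-distribˡ-+ c (f zero) _))

sumFin-*ʳ : ∀ {n} (c : ℚ) (f : Fin n → ℚ) → sumFin (λ i → f i * c) ≡ sumFin f * c
sumFin-*ʳ {zero}  c f = sym (*-zeroˡ c)
sumFin-*ʳ {suc n} c f = trans (cong (f zero * c +_) (sumFin-*ʳ c (f ∘ suc)))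
                              (sym (ℚ.*-distribʳ-+ c (f zero) _))

sumFin-linear : ∀ {n} (a b : ℚ) (f g h : Fin n → ℚ) → (∀ i → f i ≡ a * g i + b * h i) →
                sumFin f ≡ a * sumFin g + b * sumFin h
sumFin-linear a b f g h f≗ = begin
  sumFin f                                        ≡⟨ sumFin-cong f≗ ⟩
  sumFin (λ i → a * g i + b * h i)                ≡⟨ sumFin-+ (λ i → a * g i) (λ i → b * h i) ⟩
  sumFin (λ i → a * g i) + sumFin (λ i → b * h i) ≡⟨ cong₂ _+_ (sumFin-*ˡ a g) (sumFin-*ˡ b h) ⟩
  a * sumFin g + b * sumFin h                     ∎
  where open ≡-Reasoning

sumFin-swap : ∀ {n k} (F : Fin n → Fin k → ℚ) →
              sumFin (λ a → sumFin (F a)) ≡ sumFin (λ b → sumFin (λ a → F a b))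
sumFin-swap {zero} {k} F = sym (sumFin-zero {k} _ (λ _ → refl))
sumFin-swap {suc n} F = begin
  sumFin (F zero) + sumFin (λ a → sumFin (F (suc a)))
    ≡⟨ cong (sumFin (F zero) +_) (sumFin-swap (F ∘ suc)) ⟩
  sumFin (F zero) + sumFin (λ b → sumFin (λ a → F (suc a) b))
    ≡⟨ sym (sumFin-+ (F zero) _) ⟩
  sumFin (λ b → F zero b + sumFin (λ a → F (suc a) b)) ∎
  where open ≡-Reasoning

sumFin-punchIn : ∀ {n} (j : Fin (suc n)) (f : Fin (suc n) → ℚ) →
                 sumFin (f ∘ punchIn j) + f j ≡ sumFin f
sumFin-punchIn          zero    f = +-comm _ (f zero)
sumFin-punchIn {suc n} (suc j) f = trans (+-assoc (f zero) _ _)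
                                         (cong (f zero +_) (sumFin-punchIn j (f ∘ suc)))

sumFin-↑ : ∀ m {n} (f : Fin (m ℕ.+ n) → ℚ) →
           sumFin f ≡ sumFin (λ i → f (i ↑ˡ n)) + sumFin (λ i → f (m ↑ʳ i))
sumFin-↑ zero    f = sym (+-identityˡ _)
sumFin-↑ (suc m) f = trans (cong (f zero +_) (sumFin-↑ m (f ∘ suc))) (sym (+-assoc (f zero) _ _))

sumFin-offDiagonal-swap : ∀ {n} (F : Fin (suc n) → Fin (suc n) → ℚ) →
  sumFin (λ j → sumFin (λ l → F j (punchIn j l))) ≡ sumFin (λ j → sumFin (λ l → F (punchIn j l) j))
sumFin-offDiagonal-swap {n} F = +-cancelʳ (sumFin (λ j → F j j)) _ _ (begin
  sumFin (λ j → sumFin (λ l → F j (punchIn j l))) + sumFin (λ j → F j j)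
    ≡⟨ offDiagonal+diagonal F ⟩
  sumFin (λ j → sumFin (F j))
    ≡⟨ sumFin-swap F ⟩
  sumFin (λ j → sumFin (λ i → F i j))
    ≡⟨ sym (offDiagonal+diagonal (λ j i → F i j)) ⟩
  sumFin (λ j → sumFin (λ l → F (punchIn j l) j)) + sumFin (λ j → F j j) ∎)
  where
  open ≡-Reasoning
  offDiagonal+diagonal : (F : Fin (suc n) → Fin (suc n) → ℚ) →
    sumFin (λ j → sumFin (λ l → F j (punchIn j l))) + sumFin (λ j → F j j) ≡ sumFin (λ j → sumFin (F j))
  offDiagonal+diagonal F = trans (sym (sumFin-+ (λ j → sumFin (λ l → F j (punchIn j l))) (λ j → F j j)))
                                 (sumFin-cong (λ j → sumFin-punchIn j (F j)))

δ : ∀ {m} → Fin m → Fin m → ℚ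
δ j k with j Fin.≟ k
... | yes _ = 1ℚ
... | no  _ = 0ℚ

δ-refl : ∀ {m} (j : Fin m) → δ j j ≡ 1ℚ
δ-refl j with j Fin.≟ j
... | yes _  = refl
... | no j≢j = ⊥-elim (j≢j refl)

δ-≢ : ∀ {m} {j k : Fin m} → j ≢ k → δ j k ≡ 0ℚ
δ-≢ {j = j} {k} j≢k with j Fin.≟ k
... | yes j≡k = ⊥-elim (j≢k j≡k)
... | no  _   = refl

sumFin-δ : ∀ {m} (k : Fin m) (f : Fin m → ℚ) → sumFin (λ j → δ k j * f j) ≡ f k
sumFin-δ {suc m} k f = begin
  sumFin (λ j → δ k j * f j)
    ≡⟨ sym (sumFin-punchIn k (λ j → δ k j * f j)) ⟩
  sumFin (λ l → δ k (punchIn k l) * f (punchIn k l)) + δ k k * f k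
    ≡⟨ cong₂ _+_ (sumFin-zero _ (λ l → trans (cong (_* f (punchIn k l)) (δ-≢ (Fin.punchInᵢ≢i k l ∘ sym)))
                                              (*-zeroˡ (f (punchIn k l)))))
                 (trans (cong (_* f k) (δ-refl k)) (*-identityˡ (f k))) ⟩
  0ℚ + f k
    ≡⟨ +-identityˡ (f k) ⟩
  f k ∎
  where open ≡-Reasoning

sgn : ∀ {n} → Fin n → ℚ
sgn i = minusOnePow (toℕ i)

minusOnePow-+ : ∀ a b → minusOnePow (a ℕ.+ b) ≡ minusOnePow a * minusOnePow b
minusOnePow-+ zero    b = sym (*-identityˡ _)
minusOnePow-+ (suc a) b = trans (cong -_ (minusOnePow-+ a b)) (ℚ.neg-distribˡ-* (minusOnePow a) _)

neg*neg : ∀ x y → - x * - y ≡ x * y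
neg*neg = solve-∀ ℚ-ring

minusOnePow-square : ∀ a → minusOnePow a * minusOnePow a ≡ 1ℚ
minusOnePow-square zero    = refl
minusOnePow-square (suc a) = trans (neg*neg (minusOnePow a) _) (minusOnePow-square a)

laplaceTerm : ∀ {n} → Matrix (suc n) → Fin (suc n) → Fin (suc n) → ℚ
laplaceTerm M i j = sgn j * (M i j * det (minor M i j))

det-cong : ∀ {n} {M N : Matrix n} → (∀ i j → M i j ≡ N i j) → det M ≡ det N
det-cong {zero}  M≗N = refl
det-cong {suc n} M≗N = sumFin-cong (λ j → cong₂ (λ a d → sgn j * (a * d)) (M≗N zero j)
                                                 (det-cong (λ i k → M≗N (suc i) (punchIn j k))))

det-linear : ∀ {n} (r : Fin n) (a b : ℚ) (M₁ M₂ M₃ : Matrix n) →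
             (∀ i → i ≢ r → ∀ j → M₂ i j ≡ M₁ i j) → (∀ i → i ≢ r → ∀ j → M₃ i j ≡ M₁ i j) →
             (∀ j → M₁ r j ≡ a * M₂ r j + b * M₃ r j) → det M₁ ≡ a * det M₂ + b * det M₃
det-linear {suc n} zero a b M₁ M₂ M₃ M₂≗ M₃≗ row =
  sumFin-linear a b (laplaceTerm M₁ zero) (laplaceTerm M₂ zero) (laplaceTerm M₃ zero) term
  where
  open ≡-Reasoning
  term : ∀ j → laplaceTerm M₁ zero j ≡ a * laplaceTerm M₂ zero j + b * laplaceTerm M₃ zero j
  term j = begin
    sgn j * (M₁ zero j * d₁)
      ≡⟨ cong (λ x → sgn j * (x * d₁)) (row j) ⟩
    sgn j * ((a * M₂ zero j + b * M₃ zero j) * d₁)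
      ≡⟨ distrib a b (sgn j) (M₂ zero j) (M₃ zero j) d₁ ⟩
    a * (sgn j * (M₂ zero j * d₁)) + b * (sgn j * (M₃ zero j * d₁))
      ≡⟨ cong₂ (λ d₂ d₃ → a * (sgn j * (M₂ zero j * d₂)) + b * (sgn j * (M₃ zero j * d₃)))
               (det-cong (λ i k → sym (M₂≗ (suc i) (λ ()) (punchIn j k))))
               (det-cong (λ i k → sym (M₃≗ (suc i) (λ ()) (punchIn j k)))) ⟩
    a * laplaceTerm M₂ zero j + b * laplaceTerm M₃ zero j ∎
    where
    d₁ = det (minor M₁ zero j)
    distrib : ∀ a b σ x y d → σ * ((a * x + b * y) * d) ≡ a * (σ * (x * d)) + b * (σ * (y * d))
    distrib = solve-∀ ℚ-ring
det-linear {suc n} (suc r) a b M₁ M₂ M₃ M₂≗ M₃≗ row =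
  sumFin-linear a b (laplaceTerm M₁ zero) (laplaceTerm M₂ zero) (laplaceTerm M₃ zero) term
  where
  open ≡-Reasoning
  minor-linear : ∀ j → det (minor M₁ zero j) ≡ a * det (minor M₂ zero j) + b * det (minor M₃ zero j)
  minor-linear j = det-linear r a b (minor M₁ zero j) (minor M₂ zero j) (minor M₃ zero j)
    (λ i i≢r k → M₂≗ (suc i) (i≢r ∘ Fin.suc-injective) (punchIn j k))
    (λ i i≢r k → M₃≗ (suc i) (i≢r ∘ Fin.suc-injective) (punchIn j k))
    (λ k → row (punchIn j k))
  term : ∀ j → laplaceTerm M₁ zero j ≡ a * laplaceTerm M₂ zero j + b * laplaceTerm M₃ zero j
  term j = begin
    sgn j * (M₁ zero j * det (minor M₁ zero j))
      ≡⟨ cong (λ d → sgn j * (M₁ zero j * d)) (minor-linear j) ⟩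
    sgn j * (M₁ zero j * (a * det (minor M₂ zero j) + b * det (minor M₃ zero j)))
      ≡⟨ distrib a b (sgn j) (M₁ zero j) (det (minor M₂ zero j)) (det (minor M₃ zero j)) ⟩
    a * (sgn j * (M₁ zero j * det (minor M₂ zero j))) + b * (sgn j * (M₁ zero j * det (minor M₃ zero j)))
      ≡⟨ cong₂ (λ x y → a * (sgn j * (x * det (minor M₂ zero j))) + b * (sgn j * (y * det (minor M₃ zero j))))
               (sym (M₂≗ zero (λ ()) j)) (sym (M₃≗ zero (λ ()) j)) ⟩
    a * laplaceTerm M₂ zero j + b * laplaceTerm M₃ zero j ∎
    where
    distrib : ∀ a b σ x d₂ d₃ → σ * (x * (a * d₂ + b * d₃)) ≡ a * (σ * (x * d₂)) + b * (σ * (x * d₃))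
    distrib = solve-∀ ℚ-ring

-- A total variant of Data.Fin.punchOut; the value at a = b is junk.
punchOut′ : ∀ {n} → Fin (suc (suc n)) → Fin (suc (suc n)) → Fin (suc n)
punchOut′          zero    zero    = zero
punchOut′          zero    (suc b) = b
punchOut′          (suc a) zero    = zero
punchOut′ {suc n} (suc a) (suc b) = suc (punchOut′ a b)
punchOut′ {zero}  (suc a) (suc b) = zero

punchOut′-punchIn : ∀ {n} (a : Fin (suc (suc n))) (l : Fin (suc n)) → punchOut′ a (punchIn a l) ≡ l
punchOut′-punchIn          zero    l       = refl
punchOut′-punchIn          (suc a) zero    = refl
punchOut′-punchIn {suc n} (suc a) (suc l) = cong suc (punchOut′-punchIn a l)

punchIn₂ : ∀ {n} → Fin (suc (suc n)) → Fin (suc (suc n)) → Fin n → Fin (suc (suc n))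
punchIn₂ a b = punchIn a ∘ punchIn (punchOut′ a b)

punchIn₂-sym : ∀ {n} {a b : Fin (suc (suc n))} → a ≢ b → ∀ c → punchIn₂ a b c ≡ punchIn₂ b a c
punchIn₂-sym          {a = zero}  {zero}  a≢b c       = ⊥-elim (a≢b refl)
punchIn₂-sym          {a = zero}  {suc b} a≢b c       = refl
punchIn₂-sym          {a = suc a} {zero}  a≢b c       = refl
punchIn₂-sym {suc n} {a = suc a} {suc b} a≢b zero    = refl
punchIn₂-sym {suc n} {a = suc a} {suc b} a≢b (suc c) = cong suc (punchIn₂-sym (a≢b ∘ cong suc) c)

sgn-punchOut′-antisym : ∀ {n} {a b : Fin (suc (suc n))} → a ≢ b →
                        sgn a * sgn (punchOut′ a b) ≡ - (sgn b * sgn (punchOut′ b a))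
sgn-punchOut′-antisym {a = zero}  {zero}  a≢b = ⊥-elim (a≢b refl)
sgn-punchOut′-antisym {a = zero}  {suc b} a≢b = lemma (sgn b)
  where
  lemma : ∀ x → 1ℚ * x ≡ - (- x * 1ℚ)
  lemma = solve-∀ ℚ-ring
sgn-punchOut′-antisym {a = suc a} {zero}  a≢b = lemma (sgn a)
  where
  lemma : ∀ x → - x * 1ℚ ≡ - (1ℚ * x)
  lemma = solve-∀ ℚ-ring
sgn-punchOut′-antisym {suc n} {a = suc a} {suc b} a≢b = begin
  - sgn a * - sgn (punchOut′ a b)   ≡⟨ neg*neg (sgn a) _ ⟩
  sgn a * sgn (punchOut′ a b)       ≡⟨ sgn-punchOut′-antisym (a≢b ∘ cong suc) ⟩
  - (sgn b * sgn (punchOut′ b a))   ≡⟨ cong -_ (sym (neg*neg (sgn b) _)) ⟩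
  - (- sgn b * - sgn (punchOut′ b a)) ∎
  where open ≡-Reasoning
sgn-punchOut′-antisym {zero} {a = suc zero} {suc zero} a≢b = ⊥-elim (a≢b refl)

twoRowTerm : ∀ {n} → Matrix (suc (suc n)) → Fin (suc (suc n)) → Fin (suc (suc n)) → ℚ
twoRowTerm M a b = (sgn a * sgn (punchOut′ a b))
                 * (M zero a * (M (suc zero) b * det (λ r c → M (suc (suc r)) (punchIn₂ a b c))))

det-expand-two-rows : ∀ {n} (M : Matrix (suc (suc n))) →
                      det M ≡ sumFin (λ a → sumFin (λ l → twoRowTerm M a (punchIn a l)))
det-expand-two-rows M = sumFin-cong λ a → begin
  sgn a * (M zero a * sumFin (t a))               ≡⟨ cong (sgn a *_) (sym (sumFin-*ˡ (M zero a) (t a))) ⟩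
  sgn a * sumFin (λ l → M zero a * t a l)         ≡⟨ sym (sumFin-*ˡ (sgn a) (λ l → M zero a * t a l)) ⟩
  sumFin (λ l → sgn a * (M zero a * t a l))       ≡⟨ sumFin-cong (term a) ⟩
  sumFin (λ l → twoRowTerm M a (punchIn a l))     ∎
  where
  open ≡-Reasoning
  t : ∀ a l → ℚ
  t a = laplaceTerm (minor M zero a) zero
  reassoc : ∀ σ τ x y d → σ * (x * (τ * (y * d))) ≡ (σ * τ) * (x * (y * d))
  reassoc = solve-∀ ℚ-ring
  term : ∀ a l → sgn a * (M zero a * t a l) ≡ twoRowTerm M a (punchIn a l)
  term a l = trans (reassoc (sgn a) (sgn l) (M zero a) (M (suc zero) (punchIn a l)) _)
    (cong (λ b → (sgn a * sgn b) * (M zero a * (M (suc zero) (punchIn a l)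
                 * det (λ r c → M (suc (suc r)) (punchIn a (punchIn b c))))))
          (sym (punchOut′-punchIn a l)))

swapAdjacent : ∀ {n} → Fin n → Fin (suc n) → Fin (suc n)
swapAdjacent zero    zero          = suc zero
swapAdjacent zero    (suc zero)    = zero
swapAdjacent zero    (suc (suc i)) = suc (suc i)
swapAdjacent (suc p) zero          = zero
swapAdjacent (suc p) (suc i)       = suc (swapAdjacent p i)

swapAdjacent-inject₁ : ∀ {n} (p : Fin n) → swapAdjacent p (inject₁ p) ≡ suc p
swapAdjacent-inject₁ zero    = refl
swapAdjacent-inject₁ (suc p) = cong suc (swapAdjacent-inject₁ p)

swapAdjacent-suc : ∀ {n} (p : Fin n) → swapAdjacent p (suc p) ≡ inject₁ p
swapAdjacent-suc zero    = refl
swapAdjacent-suc (suc p) = cong suc (swapAdjacent-suc p)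

swapAdjacent-other : ∀ {n} (p : Fin n) {i : Fin (suc n)} → i ≢ inject₁ p → i ≢ suc p → swapAdjacent p i ≡ i
swapAdjacent-other zero    {zero}        i≢p i≢1+p = ⊥-elim (i≢p refl)
swapAdjacent-other zero    {suc zero}    i≢p i≢1+p = ⊥-elim (i≢1+p refl)
swapAdjacent-other zero    {suc (suc i)} i≢p i≢1+p = refl
swapAdjacent-other (suc p) {zero}        i≢p i≢1+p = refl
swapAdjacent-other (suc p) {suc i}       i≢p i≢1+p =
  cong suc (swapAdjacent-other p (i≢p ∘ cong suc) (i≢1+p ∘ cong suc))

swapAdjacent-punchIn : ∀ {n} (p a : Fin n) → swapAdjacent p (punchIn (inject₁ p) a) ≡ punchIn (suc p) a
swapAdjacent-punchIn zero    zero    = refl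
swapAdjacent-punchIn zero    (suc a) = refl
swapAdjacent-punchIn (suc p) zero    = refl
swapAdjacent-punchIn (suc p) (suc a) = cong suc (swapAdjacent-punchIn p a)

swapRows : ∀ {n} → Matrix (suc n) → Fin n → Matrix (suc n)
swapRows M p i = M (swapAdjacent p i)

det-swapRows-zero : ∀ {n} (M : Matrix (suc (suc n))) → det (swapRows M zero) ≡ - det M
det-swapRows-zero M = begin
  det N
    ≡⟨ det-expand-two-rows N ⟩
  sumFin (λ a → sumFin (λ l → twoRowTerm N a (punchIn a l)))
    ≡⟨ sumFin-cong (λ a → sumFin-cong (λ l → antisym (Fin.punchInᵢ≢i a l ∘ sym))) ⟩
  sumFin (λ a → sumFin (λ l → - twoRowTerm M (punchIn a l) a))
    ≡⟨ sumFin-cong (λ a → sumFin-neg (λ l → twoRowTerm M (punchIn a l) a)) ⟩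
  sumFin (λ a → - sumFin (λ l → twoRowTerm M (punchIn a l) a))
    ≡⟨ sumFin-neg (λ a → sumFin (λ l → twoRowTerm M (punchIn a l) a)) ⟩
  - sumFin (λ a → sumFin (λ l → twoRowTerm M (punchIn a l) a))
    ≡⟨ cong -_ (sym (sumFin-offDiagonal-swap (twoRowTerm M))) ⟩
  - sumFin (λ a → sumFin (λ l → twoRowTerm M a (punchIn a l)))
    ≡⟨ cong -_ (sym (det-expand-two-rows M)) ⟩
  - det M ∎
  where
  open ≡-Reasoning
  N = swapRows M zero
  exchange : ∀ σ x y d → - σ * (y * (x * d)) ≡ - (σ * (x * (y * d)))
  exchange = solve-∀ ℚ-ring
  antisym : ∀ {a b} → a ≢ b → twoRowTerm N a b ≡ - twoRowTerm M b a
  antisym {a} {b} a≢b = trans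
    (cong₂ (λ σ d → σ * (M (suc zero) a * (M zero b * d))) (sgn-punchOut′-antisym a≢b)
           (det-cong (λ r c → cong (M (suc (suc r))) (punchIn₂-sym a≢b c))))
    (exchange (sgn b * sgn (punchOut′ b a)) (M zero b) (M (suc zero) a) _)

det-swapRows : ∀ {n} (M : Matrix (suc n)) (p : Fin n) → det (swapRows M p) ≡ - det M
det-swapRows {suc n} M zero    = det-swapRows-zero M
det-swapRows {suc n} M (suc p) = begin
  sumFin (λ j → sgn j * (M zero j * det (swapRows (minor M zero j) p)))
    ≡⟨ sumFin-cong (λ j → cong (λ d → sgn j * (M zero j * d)) (det-swapRows (minor M zero j) p)) ⟩
  sumFin (λ j → sgn j * (M zero j * - det (minor M zero j)))
    ≡⟨ sumFin-cong (λ j → pull (sgn j) (M zero j) (det (minor M zero j))) ⟩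
  sumFin (λ j → - laplaceTerm M zero j)
    ≡⟨ sumFin-neg (laplaceTerm M zero) ⟩
  - det M ∎
  where
  open ≡-Reasoning
  pull : ∀ σ x d → σ * (x * - d) ≡ - (σ * (x * d))
  pull = solve-∀ ℚ-ring

x≡-x⇒x≡0 : ∀ x → x ≡ - x → x ≡ 0ℚ
x≡-x⇒x≡0 x x≡-x = begin
  x             ≡⟨ halve x ⟩
  ½ * (x + x)   ≡⟨ cong (λ y → ½ * (x + y)) x≡-x ⟩
  ½ * (x + - x) ≡⟨ cancel x ⟩
  0ℚ            ∎
  where
  open ≡-Reasoning
  halve : ∀ x → x ≡ ½ * (x + x)
  halve = solve-∀ ℚ-ring
  cancel : ∀ x → ½ * (x + - x) ≡ 0ℚ
  cancel = solve-∀ ℚ-ring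

det-equal-adjacent-rows : ∀ {n} (M : Matrix (suc n)) (p : Fin n) →
                          (∀ j → M (inject₁ p) j ≡ M (suc p) j) → det M ≡ 0ℚ
det-equal-adjacent-rows M p rows≡ = x≡-x⇒x≡0 (det M) (trans (sym (det-cong swapRows≗)) (det-swapRows M p))
  where
  swapRows≗ : ∀ i j → swapRows M p i j ≡ M i j
  swapRows≗ i j with i Fin.≟ inject₁ p | i Fin.≟ suc p
  ... | yes refl | _        = trans (cong (λ r → M r j) (swapAdjacent-inject₁ p)) (sym (rows≡ j))
  ... | no _     | yes refl = trans (cong (λ r → M r j) (swapAdjacent-suc p)) (rows≡ j)
  ... | no i≢p   | no i≢1+p = cong (λ r → M r j) (swapAdjacent-other p i≢p i≢1+p)

det-equal-rows-at-distance : ∀ d {n} (M : Matrix n) (p q : Fin n) → toℕ q ≡ suc (toℕ p ℕ.+ d) →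
                             (∀ j → M p j ≡ M q j) → det M ≡ 0ℚ
det-equal-rows-at-distance d       M p zero    () rows≡
det-equal-rows-at-distance zero    {suc n} M p (suc q) q≡ rows≡ = det-equal-adjacent-rows M q adjacent
  where
  p≡q : p ≡ inject₁ q
  p≡q = Fin.toℕ-injective (trans (sym (ℕ.+-identityʳ (toℕ p)))
                                 (trans (ℕ.suc-injective (sym q≡)) (sym (Fin.toℕ-inject₁ q))))
  adjacent : ∀ j → M (inject₁ q) j ≡ M (suc q) j
  adjacent j = trans (cong (λ r → M r j) (sym p≡q)) (rows≡ j)
det-equal-rows-at-distance (suc d) {suc n} M p (suc q) q≡ rows≡ = begin
  det M                  ≡⟨ sym (neg-involutive (det M)) ⟩
  - - det M              ≡⟨ cong -_ (sym (det-swapRows M q)) ⟩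
  - det (swapRows M q)   ≡⟨ cong -_ closer ⟩
  - 0ℚ                   ≡⟨⟩
  0ℚ                     ∎
  where
  open ≡-Reasoning
  inject₁q≡ : toℕ (inject₁ q) ≡ suc (toℕ p ℕ.+ d)
  inject₁q≡ = trans (Fin.toℕ-inject₁ q) (trans (ℕ.suc-injective q≡) (ℕ.+-suc (toℕ p) d))
  p≢q : p ≢ inject₁ q
  p≢q p≡q = ℕ.m≢1+m+n (toℕ p) (trans (cong toℕ p≡q) inject₁q≡)
  p≢1+q : p ≢ suc q
  p≢1+q p≡1+q = ℕ.m≢1+m+n (toℕ p) {suc d} (trans (cong toℕ p≡1+q) q≡)
  closer : det (swapRows M q) ≡ 0ℚ
  closer = det-equal-rows-at-distance d (swapRows M q) p (inject₁ q) inject₁q≡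
    (λ j → trans (cong (λ r → M r j) (swapAdjacent-other q p≢q p≢1+q))
                 (trans (rows≡ j) (cong (λ r → M r j) (sym (swapAdjacent-inject₁ q)))))

det-equal-rows : ∀ {n} (M : Matrix n) {p q : Fin n} → p ≢ q → (∀ j → M p j ≡ M q j) → det M ≡ 0ℚ
det-equal-rows M {p} {q} p≢q rows≡ with ℕ.<-cmp (toℕ p) (toℕ q)
... | tri< p<q _ _ = det-equal-rows-at-distance _ M p q (sym (ℕ.m+[n∸m]≡n p<q)) rows≡
... | tri≈ _ p≡q _ = ⊥-elim (p≢q (Fin.toℕ-injective p≡q))
... | tri> _ _ q<p = det-equal-rows-at-distance _ M q p (sym (ℕ.m+[n∸m]≡n q<p)) (sym ∘ rows≡)

det-expand-row-at : ∀ k {n} (M : Matrix (suc n)) (i : Fin (suc n)) → toℕ i ≡ k →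
                    sgn i * det M ≡ sumFin (laplaceTerm M i)
det-expand-row-at k       M zero    _  = *-identityˡ (det M)
det-expand-row-at (suc k) {suc n} M (suc i) i≡k = begin
  - sgn i * det M
    ≡⟨ sym (ℚ.neg-distribˡ-* (sgn i) (det M)) ⟩
  - (sgn i * det M)
    ≡⟨ ℚ.neg-distribʳ-* (sgn i) (det M) ⟩
  sgn i * - det M
    ≡⟨ cong₂ _*_ (cong minusOnePow (sym (Fin.toℕ-inject₁ i))) (sym (det-swapRows M i)) ⟩
  sgn (inject₁ i) * det (swapRows M i)
    ≡⟨ det-expand-row-at k (swapRows M i) (inject₁ i) (trans (Fin.toℕ-inject₁ i) (ℕ.suc-injective i≡k)) ⟩
  sumFin (laplaceTerm (swapRows M i) (inject₁ i))
    ≡⟨ sumFin-cong (λ w → cong₂ (λ x d → sgn w * (x * d))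
                                (cong (λ r → M r w) (swapAdjacent-inject₁ i))
                                (det-cong (λ r c → cong (λ r′ → M r′ (punchIn w c)) (swapAdjacent-punchIn i r)))) ⟩
  sumFin (laplaceTerm M (suc i)) ∎
  where open ≡-Reasoning

det-expand-row : ∀ {n} (M : Matrix (suc n)) (i : Fin (suc n)) → sgn i * det M ≡ sumFin (laplaceTerm M i)
det-expand-row M i = det-expand-row-at (toℕ i) M i refl

replaceRow : ∀ {n} → Matrix n → Fin n → (Fin n → ℚ) → Matrix n
replaceRow M r u i j with i Fin.≟ r
... | yes _ = u j
... | no  _ = M i j

replaceRow-≡ : ∀ {n} (M : Matrix n) r u j → replaceRow M r u r j ≡ u j
replaceRow-≡ M r u j with r Fin.≟ r
... | yes _   = refl
... | no r≢r = ⊥-elim (r≢r refl)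

replaceRow-≢ : ∀ {n} (M : Matrix n) r u {i} → i ≢ r → ∀ j → replaceRow M r u i j ≡ M i j
replaceRow-≢ M r u {i} i≢r j with i Fin.≟ r
... | yes i≡r = ⊥-elim (i≢r i≡r)
... | no  _   = refl

replaceRow-self : ∀ {n} (M : Matrix n) r i j → replaceRow M r (M r) i j ≡ M i j
replaceRow-self M r i j with i Fin.≟ r
... | yes refl = refl
... | no  _    = refl

det-replaceRow : ∀ {n} (M : Matrix n) (k j : Fin n) → det (replaceRow M j (M k)) ≡ det M * δ k j
det-replaceRow M k j with k Fin.≟ j
... | yes refl = trans (det-cong (replaceRow-self M k)) (sym (*-identityʳ (det M)))
... | no  k≢j  = trans (det-equal-rows (replaceRow M j (M k)) (k≢j ∘ sym)
                         (λ c → trans (replaceRow-≡ M j (M k) c) (sym (replaceRow-≢ M j (M k) k≢j c))))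
                       (sym (*-zeroʳ (det M)))

mul-adjugate : ∀ {n} (M : Matrix n) (k j : Fin n) → sumFin (λ w → M k w * adjugate M w j) ≡ det M * δ k j
mul-adjugate {suc n} M k j = begin
  sumFin (λ w → M k w * adjugate M w j)
    ≡⟨ sumFin-cong (λ w → trans (cong (λ σ → M k w * (σ * det (minor M j w))) (sgn-+ w))
                                (reassoc (sgn j) (sgn w) (M k w) _)) ⟩
  sumFin (λ w → sgn j * (sgn w * (M k w * det (minor M j w))))
    ≡⟨ sumFin-cong (λ w → cong₂ (λ x d → sgn j * (sgn w * (x * d)))
                                (sym (replaceRow-≡ M j (M k) w))
                                (det-cong (λ r c → sym (replaceRow-≢ M j (M k) (Fin.punchInᵢ≢i j r)
                                                                               (punchIn w c))))) ⟩
  sumFin (λ w → sgn j * laplaceTerm M′ j w)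
    ≡⟨ sumFin-*ˡ (sgn j) (laplaceTerm M′ j) ⟩
  sgn j * sumFin (laplaceTerm M′ j)
    ≡⟨ cong (sgn j *_) (sym (det-expand-row M′ j)) ⟩
  sgn j * (sgn j * det M′)
    ≡⟨ trans (sym (*-assoc (sgn j) (sgn j) (det M′)))
             (trans (cong (_* det M′) (minusOnePow-square (toℕ j))) (*-identityˡ (det M′))) ⟩
  det M′
    ≡⟨ det-replaceRow M k j ⟩
  det M * δ k j ∎
  where
  open ≡-Reasoning
  M′ = replaceRow M j (M k)
  sgn-+ : ∀ w → minusOnePow (toℕ w ℕ.+ toℕ j) ≡ sgn j * sgn w
  sgn-+ w = trans (minusOnePow-+ (toℕ w) (toℕ j)) (*-comm (sgn w) (sgn j))
  reassoc : ∀ σ τ x d → x * ((σ * τ) * d) ≡ σ * (τ * (x * d))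
  reassoc = solve-∀ ℚ-ring

det-addCombination : ∀ {n} q (M N : Matrix n) (r : Fin n) (c : Fin q → ℚ) (t : Fin q → Fin n) →
                     (∀ k → t k ≡ r → c k ≡ 0ℚ) →
                     (∀ i → i ≢ r → ∀ j → N i j ≡ M i j) →
                     (∀ j → N r j ≡ M r j + sumFin (λ k → c k * M (t k) j)) → det N ≡ det M
det-addCombination zero M N r c t _ others row = det-cong N≗M
  where
  N≗M : ∀ i j → N i j ≡ M i j
  N≗M i j with i Fin.≟ r
  ... | yes refl = trans (row j) (+-identityʳ (M i j))
  ... | no  i≢r  = others i i≢r j
det-addCombination (suc q) M N r c t noSelf others row = begin
  det N                           ≡⟨ det-linear r 1ℚ (c zero) N N′ P N′-others P-others N-row ⟩
  1ℚ * det N′ + c zero * det P    ≡⟨ cong₂ (λ x y → 1ℚ * x + y) det-N′ c₀-det-P ⟩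
  1ℚ * det M + 0ℚ                 ≡⟨ trans (+-identityʳ _) (*-identityˡ (det M)) ⟩
  det M                           ∎
  where
  open ≡-Reasoning
  N′ P : Matrix _
  N′ = replaceRow M r (λ j → M r j + sumFin (λ k → c (suc k) * M (t (suc k)) j))
  P  = replaceRow M r (M (t zero))
  N′-others : ∀ i → i ≢ r → ∀ j → N′ i j ≡ N i j
  N′-others i i≢r j = trans (replaceRow-≢ M r _ i≢r j) (sym (others i i≢r j))
  P-others : ∀ i → i ≢ r → ∀ j → P i j ≡ N i j
  P-others i i≢r j = trans (replaceRow-≢ M r _ i≢r j) (sym (others i i≢r j))
  split : ∀ a b x s → a + (b * x + s) ≡ 1ℚ * (a + s) + b * x
  split = solve-∀ ℚ-ring
  N-row : ∀ j → N r j ≡ 1ℚ * N′ r j + c zero * P r j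
  N-row j = trans (row j) (trans (split (M r j) (c zero) (M (t zero) j) _)
                 (sym (cong₂ (λ x y → 1ℚ * x + c zero * y) (replaceRow-≡ M r _ j) (replaceRow-≡ M r _ j))))
  det-N′ : det N′ ≡ det M
  det-N′ = det-addCombination q M N′ r (c ∘ suc) (t ∘ suc) (noSelf ∘ suc)
             (λ i i≢r j → replaceRow-≢ M r _ i≢r j) (replaceRow-≡ M r _)
  c₀-det-P : c zero * det P ≡ 0ℚ
  c₀-det-P with t zero Fin.≟ r
  ... | yes t₀≡r = trans (cong (_* det P) (noSelf zero t₀≡r)) (*-zeroˡ (det P))
  ... | no  t₀≢r = trans (cong (c zero *_) (det-equal-rows P (t₀≢r ∘ sym) P-rows≡)) (*-zeroʳ (c zero))
    where
    P-rows≡ : ∀ j → P r j ≡ P (t zero) j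
    P-rows≡ j = trans (replaceRow-≡ M r _ j) (sym (replaceRow-≢ M r _ t₀≢r j))

addRowCombinations : ∀ {n q} → Matrix n → (Fin n → Fin q → ℚ) → (Fin n → Fin q → Fin n) → Matrix n
addRowCombinations M c t r j = M r j + sumFin (λ k → c r k * M (t r k) j)

addRowCombinations-unchanged : ∀ {n q} (M : Matrix n) c (t : Fin n → Fin q → Fin n) r →
                               (∀ k → c r k ≡ 0ℚ) → ∀ j → addRowCombinations M c t r j ≡ M r j
addRowCombinations-unchanged M c t r c≡0 j =
  trans (cong (M r j +_) (sumFin-zero _ (λ k → trans (cong (_* M (t r k) j) (c≡0 k)) (*-zeroˡ (M (t r k) j)))))
        (+-identityʳ (M r j))

addRowCombinationsBelow : ∀ {n q} → ℕ → Matrix n → (Fin n → Fin q → ℚ) → (Fin n → Fin q → Fin n) →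
                          Matrix n
addRowCombinationsBelow m M c t r j with toℕ r ℕ.<? m
... | yes _ = addRowCombinations M c t r j
... | no  _ = M r j

SourceRowsUnchanged : ∀ {n q} → (Fin n → Fin q → ℚ) → (Fin n → Fin q → Fin n) → Set
SourceRowsUnchanged c t = ∀ r k → c r k ≡ 0ℚ ⊎ (∀ k′ → c (t r k) k′ ≡ 0ℚ)

module _ {n q} (M : Matrix n) (c : Fin n → Fin q → ℚ) (t : Fin n → Fin q → Fin n) where

  private
    B : ℕ → Matrix n
    B m = addRowCombinationsBelow m M c t

    below-< : ∀ {m} r → toℕ r ℕ.< m → ∀ j → B m r j ≡ addRowCombinations M c t r j
    below-< {m} r r<m j with toℕ r ℕ.<? m
    ... | yes _   = refl
    ... | no  r≮m = ⊥-elim (r≮m r<m)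

    below-≮ : ∀ {m} r → ¬ toℕ r ℕ.< m → ∀ j → B m r j ≡ M r j
    below-≮ {m} r r≮m j with toℕ r ℕ.<? m
    ... | yes r<m = ⊥-elim (r≮m r<m)
    ... | no  _   = refl

    below-unchanged : ∀ m r → (∀ k → c r k ≡ 0ℚ) → ∀ j → B m r j ≡ M r j
    below-unchanged m r c≡0 j with toℕ r ℕ.<? m
    ... | yes _ = addRowCombinations-unchanged M c t r c≡0 j
    ... | no  _ = refl

    below-suc-≢ : ∀ {m} r → toℕ r ≢ m → ∀ j → B (suc m) r j ≡ B m r j
    below-suc-≢ {m} r r≢m j with toℕ r ℕ.<? m
    ... | yes r<m = below-< r (ℕ.m<n⇒m<1+n r<m) j
    ... | no  r≮m = below-≮ r (λ r<1+m → r≮m (ℕ.≤∧≢⇒< (ℕ.s≤s⁻¹ r<1+m) r≢m)) j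

    det-addRowCombinationsBelow : SourceRowsUnchanged c t → ∀ m → m ℕ.≤ n → det (B m) ≡ det M
    det-addRowCombinationsBelow fixed zero    _   = det-cong (λ r → below-≮ {0} r (λ ()))
    det-addRowCombinationsBelow fixed (suc m) m<n =
      trans (det-addCombination q (B m) (B (suc m)) r₀ (c r₀) (t r₀) noSelf others row)
            (det-addRowCombinationsBelow fixed m (ℕ.<⇒≤ m<n))
      where
      open ≡-Reasoning
      r₀ = fromℕ< m<n
      r₀≡m : toℕ r₀ ≡ m
      r₀≡m = Fin.toℕ-fromℕ< m<n
      noSelf : ∀ k → t r₀ k ≡ r₀ → c r₀ k ≡ 0ℚ
      noSelf k t≡r₀ with fixed r₀ k
      ... | inj₁ c≡0      = c≡0
      ... | inj₂ unchanged = trans (cong (λ r → c r k) (sym t≡r₀)) (unchanged k)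
      others : ∀ i → i ≢ r₀ → ∀ j → B (suc m) i j ≡ B m i j
      others i i≢r₀ = below-suc-≢ i (λ i≡m → i≢r₀ (Fin.toℕ-injective (trans i≡m (sym r₀≡m))))
      zero-coefficient : ∀ {a} x y → a ≡ 0ℚ → a * x ≡ a * y
      zero-coefficient x y refl = trans (*-zeroˡ x) (sym (*-zeroˡ y))
      source : ∀ j k → c r₀ k * M (t r₀ k) j ≡ c r₀ k * B m (t r₀ k) j
      source j k with fixed r₀ k
      ... | inj₁ c≡0       = zero-coefficient _ _ c≡0
      ... | inj₂ unchanged = cong (c r₀ k *_) (sym (below-unchanged m (t r₀ k) unchanged j))
      row : ∀ j → B (suc m) r₀ j ≡ B m r₀ j + sumFin (λ k → c r₀ k * B m (t r₀ k) j)
      row j = begin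
        B (suc m) r₀ j                                ≡⟨ below-< r₀ (ℕ.≤-reflexive (cong suc r₀≡m)) j ⟩
        M r₀ j + sumFin (λ k → c r₀ k * M (t r₀ k) j)
          ≡⟨ cong₂ _+_ (sym (below-≮ r₀ (ℕ.<-irrefl r₀≡m) j)) (sumFin-cong (source j)) ⟩
        B m r₀ j + sumFin (λ k → c r₀ k * B m (t r₀ k) j) ∎

  det-addRowCombinations : SourceRowsUnchanged c t → det (addRowCombinations M c t) ≡ det M
  det-addRowCombinations fixed =
    trans (det-cong (λ r → sym ∘ below-< r (Fin.toℕ<n r))) (det-addRowCombinationsBelow fixed n ℕ.≤-refl)

punchIn-↑ˡ : ∀ {a} b (j : Fin (suc a)) (k : Fin a) → punchIn (j ↑ˡ b) (k ↑ˡ b) ≡ punchIn j k ↑ˡ b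
punchIn-↑ˡ b zero    k       = refl
punchIn-↑ˡ b (suc j) zero    = refl
punchIn-↑ˡ b (suc j) (suc k) = cong suc (punchIn-↑ˡ b j k)

punchIn-↑ʳ : ∀ a {b} (j : Fin (suc a)) (k : Fin b) → punchIn (j ↑ˡ b) (a ↑ʳ k) ≡ suc a ↑ʳ k
punchIn-↑ʳ a       zero    k = refl
punchIn-↑ʳ (suc a) (suc j) k = cong suc (punchIn-↑ʳ a j k)

det-blockLowerTriangular : ∀ a {b} (M : Matrix (a ℕ.+ b)) → (∀ i j → M (i ↑ˡ b) (a ↑ʳ j) ≡ 0ℚ) →
                           det M ≡ det (λ i j → M (i ↑ˡ b) (j ↑ˡ b)) * det (λ i j → M (a ↑ʳ i) (a ↑ʳ j))
det-blockLowerTriangular zero    M _ = sym (*-identityˡ _)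
det-blockLowerTriangular (suc a) {b} M upperRight≡0 = begin
  det M
    ≡⟨ sumFin-↑ (suc a) (laplaceTerm M zero) ⟩
  sumFin (λ j → laplaceTerm M zero (j ↑ˡ b)) + sumFin (λ j → laplaceTerm M zero (suc a ↑ʳ j))
    ≡⟨ cong₂ _+_ (sumFin-cong left) (sumFin-zero _ right) ⟩
  sumFin (λ j → laplaceTerm A zero j * det D) + 0ℚ
    ≡⟨ trans (+-identityʳ _) (sumFin-*ʳ (det D) (laplaceTerm A zero)) ⟩
  det A * det D ∎
  where
  open ≡-Reasoning
  A : Matrix (suc a)
  A i j = M (i ↑ˡ b) (j ↑ˡ b)
  D : Matrix b
  D i j = M (suc a ↑ʳ i) (suc a ↑ʳ j)
  reassoc : ∀ σ x d e → σ * (x * (d * e)) ≡ (σ * (x * d)) * e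
  reassoc = solve-∀ ℚ-ring
  minor-det : ∀ j → det (minor M zero (j ↑ˡ b)) ≡ det (minor A zero j) * det D
  minor-det j = trans
    (det-blockLowerTriangular a (minor M zero (j ↑ˡ b))
      (λ i k → trans (cong (M (suc (i ↑ˡ b))) (punchIn-↑ʳ a j k)) (upperRight≡0 (suc i) k)))
    (cong₂ _*_ (det-cong (λ i k → cong (M (suc (i ↑ˡ b))) (punchIn-↑ˡ b j k)))
               (det-cong (λ i k → cong (M (suc (a ↑ʳ i))) (punchIn-↑ʳ a j k))))
  left : ∀ j → laplaceTerm M zero (j ↑ˡ b) ≡ laplaceTerm A zero j * det D
  left j = trans (cong₂ (λ σ d → σ * (M zero (j ↑ˡ b) * d)) (cong minusOnePow (Fin.toℕ-↑ˡ j b)) (minor-det j))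
                 (reassoc (sgn j) (A zero j) _ _)
  right : ∀ j → laplaceTerm M zero (suc a ↑ʳ j) ≡ 0ℚ
  right j = trans (cong (λ x → sgn (suc a ↑ʳ j) * (x * det (minor M zero (suc a ↑ʳ j)))) (upperRight≡0 zero j))
                  (trans (cong (sgn (suc a ↑ʳ j) *_) (*-zeroˡ (det (minor M zero (suc a ↑ʳ j)))))
                         (*-zeroʳ (sgn (suc a ↑ʳ j))))

blockEntry : ∀ {n m} → Matrix m → Fin n × Fin m → Fin n × Fin m → ℚ
blockEntry T (k , w) (k′ , w′) with k Fin.≟ k′
... | yes _ = T w w′
... | no  _ = 0ℚ

blockEntry-same : ∀ {n m} (T : Matrix m) (k : Fin n) w w′ → blockEntry T (k , w) (k , w′) ≡ T w w′
blockEntry-same T k w w′ with k Fin.≟ k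
... | yes _   = refl
... | no k≢k = ⊥-elim (k≢k refl)

blockEntry-≢ : ∀ {n m} (T : Matrix m) {k k′ : Fin n} w w′ → k ≢ k′ → blockEntry T (k , w) (k′ , w′) ≡ 0ℚ
blockEntry-≢ T {k} {k′} w w′ k≢k′ with k Fin.≟ k′
... | yes k≡k′ = ⊥-elim (k≢k′ k≡k′)
... | no  _    = refl

blockEntry-suc : ∀ {n m} (T : Matrix m) (a a′ : Fin n × Fin m) →
                 blockEntry T (map₁ suc a) (map₁ suc a′) ≡ blockEntry T a a′
blockEntry-suc T (k , w) (k′ , w′) = byCases (k Fin.≟ k′)
  where
  byCases : Dec (k ≡ k′) → blockEntry T (suc k , w) (suc k′ , w′) ≡ blockEntry T (k , w) (k′ , w′)
  byCases (yes refl) = trans (blockEntry-same T (suc k) w w′) (sym (blockEntry-same T k w w′))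
  byCases (no k≢k′)  = trans (blockEntry-≢ T w w′ (k≢k′ ∘ Fin.suc-injective))
                             (sym (blockEntry-≢ T w w′ k≢k′))

blockDiagonal : ∀ n {m} → Matrix m → Matrix (n ℕ.* m)
blockDiagonal n {m} T p p′ = blockEntry T (remQuot {n} m p) (remQuot {n} m p′)

remQuot-↑ˡ : ∀ {n} m (i : Fin m) → remQuot {suc n} m (i ↑ˡ (n ℕ.* m)) ≡ (zero , i)
remQuot-↑ˡ {n} m i rewrite Fin.splitAt-↑ˡ m i (n ℕ.* m) = refl

remQuot-↑ʳ : ∀ {n} m (p : Fin (n ℕ.* m)) → remQuot {suc n} m (m ↑ʳ p) ≡ map₁ suc (remQuot {n} m p)
remQuot-↑ʳ {n} m p rewrite Fin.splitAt-↑ʳ m (n ℕ.* m) p = refl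

det-blockDiagonal : ∀ n {m} (T : Matrix m) → det (blockDiagonal n T) ≡ det T ^ n
det-blockDiagonal zero    T = refl
det-blockDiagonal (suc n) {m} T = begin
  det (blockDiagonal (suc n) T)
    ≡⟨ det-blockLowerTriangular m (blockDiagonal (suc n) T) upperRight≡0 ⟩
  det (λ i j → blockDiagonal (suc n) T (i ↑ˡ n ℕ.* m) (j ↑ˡ n ℕ.* m))
    * det (λ p p′ → blockDiagonal (suc n) T (m ↑ʳ p) (m ↑ʳ p′))
    ≡⟨ cong₂ _*_ (det-cong firstBlock) (trans (det-cong otherBlocks) (det-blockDiagonal n T)) ⟩
  det T * det T ^ n ∎
  where
  open ≡-Reasoning
  upperRight≡0 : ∀ i p → blockDiagonal (suc n) T (i ↑ˡ n ℕ.* m) (m ↑ʳ p) ≡ 0ℚ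
  upperRight≡0 i p = cong₂ (blockEntry T) (remQuot-↑ˡ {n} m i) (remQuot-↑ʳ {n} m p)
  firstBlock : ∀ i j → blockDiagonal (suc n) T (i ↑ˡ n ℕ.* m) (j ↑ˡ n ℕ.* m) ≡ T i j
  firstBlock i j = trans (cong₂ (blockEntry T) (remQuot-↑ˡ {n} m i) (remQuot-↑ˡ {n} m j))
                         (blockEntry-same T (zero {n}) i j)
  otherBlocks : ∀ p p′ → blockDiagonal (suc n) T (m ↑ʳ p) (m ↑ʳ p′) ≡ blockDiagonal n T p p′
  otherBlocks p p′ = trans (cong₂ (blockEntry T) (remQuot-↑ʳ {n} m p) (remQuot-↑ʳ {n} m p′))
                           (blockEntry-suc T (remQuot {n} m p) (remQuot {n} m p′))

mul-inverse : ∀ {n} (M : Matrix n) (nz : det M ≢ 0ℚ) (k j : Fin n) →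
              sumFin (λ w → M k w * inverse M nz w j) ≡ δ k j
mul-inverse M nz k j = begin
  sumFin (λ w → M k w * (d⁻¹ * adjugate M w j))  ≡⟨ sumFin-cong (λ w → swap-scalar (M k w) d⁻¹ _) ⟩
  sumFin (λ w → d⁻¹ * (M k w * adjugate M w j))  ≡⟨ sumFin-*ˡ d⁻¹ (λ w → M k w * adjugate M w j) ⟩
  d⁻¹ * sumFin (λ w → M k w * adjugate M w j)    ≡⟨ cong (d⁻¹ *_) (mul-adjugate M k j) ⟩
  d⁻¹ * (det M * δ k j)                          ≡⟨ sym (*-assoc d⁻¹ (det M) (δ k j)) ⟩
  (d⁻¹ * det M) * δ k j                          ≡⟨ cong (_* δ k j) (ℚ.*-inverseˡ (det M) {{≢-nonZero nz}}) ⟩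
  1ℚ * δ k j                                     ≡⟨ *-identityˡ (δ k j) ⟩
  δ k j                                          ∎
  where
  open ≡-Reasoning
  d⁻¹ : ℚ
  d⁻¹ = (1/ det M) {{≢-nonZero nz}}
  swap-scalar : ∀ x a y → x * (a * y) ≡ a * (x * y)
  swap-scalar = solve-∀ ℚ-ring

idMinus-diagonal : ∀ {n} (A : Matrix n) x i → idMinus x A i i ≡ x - A i i
idMinus-diagonal A x i with i Fin.≟ i
... | yes _   = refl
... | no i≢i = ⊥-elim (i≢i refl)

idMinus-≢ : ∀ {n} (A : Matrix n) x {i j} → i ≢ j → idMinus x A i j ≡ - A i j
idMinus-≢ A x {i} {j} i≢j with i Fin.≟ j
... | yes i≡j = ⊥-elim (i≢j i≡j)
... | no  _   = refl

idMinus-sym : ∀ {n} (A : Matrix n) x → (∀ i j → A i j ≡ A j i) → ∀ i j → idMinus x A i j ≡ idMinus x A j i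
idMinus-sym A x A-sym i j = byCases (i Fin.≟ j)
  where
  byCases : Dec (i ≡ j) → idMinus x A i j ≡ idMinus x A j i
  byCases (yes refl) = refl
  byCases (no i≢j)   = trans (idMinus-≢ A x i≢j) (trans (cong -_ (A-sym i j)) (sym (idMinus-≢ A x (i≢j ∘ sym))))

signToℚ-* : ∀ s t → signToℚ (s *ₛ t) ≡ signToℚ s * signToℚ t
signToℚ-* Sign.+ Sign.+ = refl
signToℚ-* Sign.+ Sign.- = refl
signToℚ-* Sign.- Sign.+ = refl
signToℚ-* Sign.- Sign.- = refl

signToℚ-square : ∀ s → signToℚ s * signToℚ s ≡ 1ℚ
signToℚ-square Sign.+ = refl
signToℚ-square Sign.- = refl

vertexIndex : ∀ n m → Vtx n m → Fin (n ℕ.+ n ℕ.* m)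
vertexIndex n m (inj₁ i)       = i ↑ˡ (n ℕ.* m)
vertexIndex n m (inj₂ (k , w)) = n ↑ʳ combine k w

classify-↑ˡ : ∀ n m (i : Fin n) → classify n m (i ↑ˡ (n ℕ.* m)) ≡ inj₁ i
classify-↑ˡ n m i rewrite Fin.splitAt-↑ˡ n i (n ℕ.* m) = refl

classify-↑ʳ : ∀ n m (p : Fin (n ℕ.* m)) → classify n m (n ↑ʳ p) ≡ inj₂ (remQuot m p)
classify-↑ʳ n m p rewrite Fin.splitAt-↑ʳ n (n ℕ.* m) p = refl

classify-vertexIndex : ∀ n m (a : Vtx n m) → classify n m (vertexIndex n m a) ≡ a
classify-vertexIndex n m (inj₁ i)       = classify-↑ˡ n m i
classify-vertexIndex n m (inj₂ (k , w)) = trans (classify-↑ʳ n m (combine k w)) (cong inj₂ (Fin.remQuot-combine k w))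

vertexIndex-classify : ∀ n m (u : Fin (n ℕ.+ n ℕ.* m)) → vertexIndex n m (classify n m u) ≡ u
vertexIndex-classify n m u with splitAt n u | Fin.join-splitAt n (n ℕ.* m) u
... | inj₁ i | join≡u = join≡u
... | inj₂ p | join≡u = trans (cong (n ↑ʳ_) (Fin.combine-remQuot {n} m p)) join≡u

classify-injective : ∀ n m {u v} → classify n m u ≡ classify n m v → u ≡ v
classify-injective n m {u} {v} eq =
  trans (sym (vertexIndex-classify n m u)) (trans (cong (vertexIndex n m) eq) (vertexIndex-classify n m v))

vtxMatrix : ∀ n m → (Vtx n m → Vtx n m → ℚ) → Matrix (n ℕ.+ n ℕ.* m)
vtxMatrix n m E u v = E (classify n m u) (classify n m v)

det-vtxMatrix-blockLowerTriangular :
  ∀ n {m} (E : Vtx n m → Vtx n m → ℚ) (T : Matrix m) →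
  (∀ i a → E (inj₁ i) (inj₂ a) ≡ 0ℚ) → (∀ a a′ → E (inj₂ a) (inj₂ a′) ≡ blockEntry T a a′) →
  det (vtxMatrix n m E) ≡ det (λ i j → E (inj₁ i) (inj₁ j)) * det T ^ n
det-vtxMatrix-blockLowerTriangular n {m} E T upperRight≡0 lowerRight≡T = begin
  det (vtxMatrix n m E)
    ≡⟨ det-blockLowerTriangular n (vtxMatrix n m E)
         (λ i p → trans (cong₂ E (classify-↑ˡ n m i) (classify-↑ʳ n m p)) (upperRight≡0 i _)) ⟩
  det (λ i j → vtxMatrix n m E (i ↑ˡ n ℕ.* m) (j ↑ˡ n ℕ.* m))
    * det (λ p p′ → vtxMatrix n m E (n ↑ʳ p) (n ↑ʳ p′))
    ≡⟨ cong₂ _*_ (det-cong (λ i j → cong₂ E (classify-↑ˡ n m i) (classify-↑ˡ n m j)))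
                 (trans (det-cong lowerRight) (det-blockDiagonal n T)) ⟩
  det (λ i j → E (inj₁ i) (inj₁ j)) * det T ^ n ∎
  where
  open ≡-Reasoning
  lowerRight : ∀ p p′ → vtxMatrix n m E (n ↑ʳ p) (n ↑ʳ p′) ≡ blockDiagonal n T p p′
  lowerRight p p′ = trans (cong₂ E (classify-↑ʳ n m p) (classify-↑ʳ n m p′)) (lowerRight≡T _ _)

idMinus-shift : ∀ {n} (A : Matrix n) x c i j → idMinus (x - c) A i j ≡ idMinus x A i j + - (c * δ i j)
idMinus-shift A x c i j with i Fin.≟ j
... | yes _ = shift x c (A i j)
  where
  shift : ∀ x c a → x - c - a ≡ x - a + - (c * 1ℚ)
  shift = solve-∀ ℚ-ring
... | no _ = sym (trans (cong (λ z → - A i j + - z) (*-zeroʳ c)) (+-identityʳ (- A i j)))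

module CoronaCharacteristicMatrix {n m} (G : SignedGraph n) (H : SignedGraph m) (x : ℚ) where

  μ : Fin n → ℚ
  μ l = signToℚ (marking G l)

  μ′ : Fin m → ℚ
  μ′ w = signToℚ (marking H w)

  T : Matrix m
  T = idMinus x (adjMatrix H)

  E : Vtx n m → Vtx n m → ℚ
  E (inj₁ i)       (inj₁ j)       = idMinus x (adjMatrix G) i j
  E (inj₁ l)       (inj₂ (k , w)) = - entry (spoke G H l k w)
  E (inj₂ (k , w)) (inj₁ l)       = - entry (spoke G H l k w)
  E (inj₂ a)       (inj₂ a′)      = blockEntry T a a′

  E-diagonal : ∀ a → E a a ≡ x - entry (coronaEdge' G H a a)
  E-diagonal (inj₁ i) = idMinus-diagonal (adjMatrix G) x i
  E-diagonal (inj₂ (k , w)) with k Fin.≟ k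
  ... | yes _   = idMinus-diagonal (adjMatrix H) x w
  ... | no k≢k = ⊥-elim (k≢k refl)

  E-≢ : ∀ {a a′} → a ≢ a′ → E a a′ ≡ - entry (coronaEdge' G H a a′)
  E-≢ {inj₁ i}       {inj₁ j}         a≢a′ = idMinus-≢ (adjMatrix G) x (a≢a′ ∘ cong inj₁)
  E-≢ {inj₁ l}       {inj₂ (k , w)}   a≢a′ = refl
  E-≢ {inj₂ (k , w)} {inj₁ l}         a≢a′ = refl
  E-≢ {inj₂ (k , w)} {inj₂ (k′ , w′)} a≢a′ with k Fin.≟ k′
  ... | yes refl = idMinus-≢ (adjMatrix H) x (a≢a′ ∘ cong (λ v → inj₂ (k , v)))
  ... | no  _    = refl

  idMinus-corona : ∀ u v → idMinus x (adjMatrix (corona G H)) u v ≡ vtxMatrix n m E u v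
  idMinus-corona u v with u Fin.≟ v
  ... | yes refl = sym (E-diagonal (classify n m u))
  ... | no  u≢v  = sym (E-≢ (u≢v ∘ classify-injective n m))

  spoke-same : ∀ l w → entry (spoke G H l l w) ≡ μ l * μ′ w
  spoke-same l w with l Fin.≟ l
  ... | yes _   = signToℚ-* (marking G l) (marking H w)
  ... | no l≢l = ⊥-elim (l≢l refl)

  spoke-≢ : ∀ {l k} w → l ≢ k → spoke G H l k w ≡ nothing
  spoke-≢ {l} {k} w l≢k with l Fin.≟ k
  ... | yes l≡k = ⊥-elim (l≢k l≡k)
  ... | no  _   = refl

  module Elimination (nz : charPoly H x ≢ 0ℚ) where

    χ : ℚ
    χ = coronal H x nz

    b : Fin m → ℚ
    b w = sumFin (λ j → inverse T nz w j * μ′ j)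

    bT≡μ′ : ∀ w′ → sumFin (λ w → b w * T w w′) ≡ μ′ w′
    bT≡μ′ w′ = begin
      sumFin (λ w → b w * T w w′)
        ≡⟨ sumFin-cong (λ w → cong (b w *_) (T-sym w w′)) ⟩
      sumFin (λ w → b w * T w′ w)
        ≡⟨ sumFin-cong (λ w → trans (sym (sumFin-*ʳ (T w′ w) (λ j → inverse T nz w j * μ′ j)))
                                    (sumFin-cong (λ j → rearrange (inverse T nz w j) (μ′ j) (T w′ w)))) ⟩
      sumFin (λ w → sumFin (λ j → μ′ j * (T w′ w * inverse T nz w j)))
        ≡⟨ sumFin-swap (λ w j → μ′ j * (T w′ w * inverse T nz w j)) ⟩
      sumFin (λ j → sumFin (λ w → μ′ j * (T w′ w * inverse T nz w j)))
        ≡⟨ sumFin-cong (λ j → sumFin-*ˡ (μ′ j) (λ w → T w′ w * inverse T nz w j)) ⟩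
      sumFin (λ j → μ′ j * sumFin (λ w → T w′ w * inverse T nz w j))
        ≡⟨ sumFin-cong (λ j → trans (cong (μ′ j *_) (mul-inverse T nz w′ j)) (*-comm (μ′ j) (δ w′ j))) ⟩
      sumFin (λ j → δ w′ j * μ′ j)
        ≡⟨ sumFin-δ w′ μ′ ⟩
      μ′ w′ ∎
      where
      open ≡-Reasoning
      T-sym : ∀ i j → T i j ≡ T j i
      T-sym = idMinus-sym (adjMatrix H) x (λ i j → cong entry (edge-sym H i j))
      rearrange : ∀ a y t → a * y * t ≡ y * (t * a)
      rearrange = solve-∀ ℚ-ring

    χ≡bμ′ : χ ≡ sumFin (λ w → b w * μ′ w)
    χ≡bμ′ = sumFin-cong (λ w → trans (sumFin-cong (λ j → regroup (μ′ w) (inverse T nz w j) (μ′ j)))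
                                     (sumFin-*ʳ (μ′ w) (λ j → inverse T nz w j * μ′ j)))
      where
      regroup : ∀ a y t → a * (y * t) ≡ y * t * a
      regroup = solve-∀ ℚ-ring

    coefficient : Vtx n m → Fin m → ℚ
    coefficient (inj₁ l) w = μ l * b w
    coefficient (inj₂ _) _ = 0ℚ

    target : Vtx n m → Fin m → Vtx n m
    target (inj₁ l) w = inj₂ (l , w)
    target (inj₂ a) _ = inj₂ a

    coefficient-target : ∀ a w w′ → coefficient (target a w) w′ ≡ 0ℚ
    coefficient-target (inj₁ _) _ _ = refl
    coefficient-target (inj₂ _) _ _ = refl

    reduced : Vtx n m → Vtx n m → ℚ
    reduced (inj₁ i) (inj₁ j) = idMinus (x - χ) (adjMatrix G) i j
    reduced (inj₁ _) (inj₂ _) = 0ℚ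
    reduced (inj₂ a) a′       = E (inj₂ a) a′

    spokes-into-G : ∀ l l′ → sumFin (λ w → coefficient (inj₁ l) w * E (target (inj₁ l) w) (inj₁ l′))
                             ≡ - (χ * δ l l′)
    spokes-into-G l l′ = byCases (l Fin.≟ l′)
      where
      open ≡-Reasoning
      rearrange : ∀ a y t → a * y * - (a * t) ≡ - (a * a * (y * t))
      rearrange = solve-∀ ℚ-ring
      byCases : Dec (l ≡ l′) → sumFin (λ w → μ l * b w * - entry (spoke G H l′ l w)) ≡ - (χ * δ l l′)
      byCases (yes refl) = begin
        sumFin (λ w → μ l * b w * - entry (spoke G H l l w))
          ≡⟨ sumFin-cong (λ w → trans (cong (λ e → μ l * b w * - e) (spoke-same l w))
                                      (rearrange (μ l) (b w) (μ′ w))) ⟩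
        sumFin (λ w → - (μ l * μ l * (b w * μ′ w)))
          ≡⟨ sumFin-neg (λ w → μ l * μ l * (b w * μ′ w)) ⟩
        - sumFin (λ w → μ l * μ l * (b w * μ′ w))
          ≡⟨ cong -_ (sumFin-*ˡ (μ l * μ l) (λ w → b w * μ′ w)) ⟩
        - (μ l * μ l * sumFin (λ w → b w * μ′ w))
          ≡⟨ cong₂ (λ s t → - (s * t)) (signToℚ-square (marking G l)) (sym χ≡bμ′) ⟩
        - (1ℚ * χ)
          ≡⟨ cong -_ (trans (*-identityˡ χ) (sym (trans (cong (χ *_) (δ-refl l)) (*-identityʳ χ)))) ⟩
        - (χ * δ l l) ∎
      byCases (no l≢l′) = begin
        sumFin (λ w → μ l * b w * - entry (spoke G H l′ l w))
          ≡⟨ sumFin-zero _ (λ w → trans (cong (λ e → μ l * b w * - entry e) (spoke-≢ w (l≢l′ ∘ sym)))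
                                        (*-zeroʳ (μ l * b w))) ⟩
        - 0ℚ
          ≡⟨ cong -_ (sym (trans (cong (χ *_) (δ-≢ l≢l′)) (*-zeroʳ χ))) ⟩
        - (χ * δ l l′) ∎

    spokes-into-H : ∀ l k w′ → E (inj₁ l) (inj₂ (k , w′))
                               + sumFin (λ w → coefficient (inj₁ l) w * E (target (inj₁ l) w) (inj₂ (k , w′))) ≡ 0ℚ
    spokes-into-H l k w′ = byCases (l Fin.≟ k)
      where
      open ≡-Reasoning
      byCases : Dec (l ≡ k) →
                - entry (spoke G H l k w′) + sumFin (λ w → μ l * b w * blockEntry T (l , w) (k , w′)) ≡ 0ℚ
      byCases (yes refl) = begin
        - entry (spoke G H l l w′) + sumFin (λ w → μ l * b w * blockEntry T (l , w) (l , w′))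
          ≡⟨ cong₂ (λ e s → - e + s) (spoke-same l w′)
                   (sumFin-cong (λ w → trans (cong (μ l * b w *_) (blockEntry-same T l w w′)) (*-assoc (μ l) (b w) _))) ⟩
        - (μ l * μ′ w′) + sumFin (λ w → μ l * (b w * T w w′))
          ≡⟨ cong (- (μ l * μ′ w′) +_) (trans (sumFin-*ˡ (μ l) (λ w → b w * T w w′))
                                              (cong (μ l *_) (bT≡μ′ w′))) ⟩
        - (μ l * μ′ w′) + μ l * μ′ w′
          ≡⟨ ℚ.+-inverseˡ (μ l * μ′ w′) ⟩
        0ℚ ∎
      byCases (no l≢k) = begin
        - entry (spoke G H l k w′) + sumFin (λ w → μ l * b w * blockEntry T (l , w) (k , w′))
          ≡⟨ cong₂ (λ e s → - entry e + s) (spoke-≢ w′ l≢k)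
                   (sumFin-zero _ (λ w → trans (cong (μ l * b w *_) (blockEntry-≢ T w w′ l≢k))
                                               (*-zeroʳ (μ l * b w)))) ⟩
        0ℚ ∎

    reduced-row : ∀ a a′ → reduced a a′ ≡ E a a′ + sumFin (λ w → coefficient a w * E (target a w) a′)
    reduced-row (inj₁ l) (inj₁ l′)       = trans (idMinus-shift (adjMatrix G) x χ l l′)
                                                 (cong (idMinus x (adjMatrix G) l l′ +_) (sym (spokes-into-G l l′)))
    reduced-row (inj₁ l) (inj₂ (k , w′)) = sym (spokes-into-H l k w′)
    reduced-row (inj₂ a) a′              =
      sym (trans (cong (E (inj₂ a) a′ +_) (sumFin-zero _ (λ w → *-zeroˡ (E (target (inj₂ a) w) a′))))
                 (+-identityʳ (E (inj₂ a) a′)))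

    det-reduced : det (vtxMatrix n m E) ≡ det (vtxMatrix n m reduced)
    det-reduced = begin
      det (vtxMatrix n m E)
        ≡⟨ sym (det-addRowCombinations (vtxMatrix n m E) c t sourcesUnchanged) ⟩
      det (addRowCombinations (vtxMatrix n m E) c t)
        ≡⟨ det-cong combined ⟩
      det (vtxMatrix n m reduced) ∎
      where
      open ≡-Reasoning
      c : Fin (n ℕ.+ n ℕ.* m) → Fin m → ℚ
      c u = coefficient (classify n m u)
      t : Fin (n ℕ.+ n ℕ.* m) → Fin m → Fin (n ℕ.+ n ℕ.* m)
      t u w = vertexIndex n m (target (classify n m u) w)
      classify-t : ∀ u w → classify n m (t u w) ≡ target (classify n m u) w
      classify-t u w = classify-vertexIndex n m (target (classify n m u) w)
      sourcesUnchanged : SourceRowsUnchanged c t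
      sourcesUnchanged u w = inj₂ (λ w′ → trans (cong (λ a → coefficient a w′) (classify-t u w))
                                                (coefficient-target (classify n m u) w w′))
      combined : ∀ u v → addRowCombinations (vtxMatrix n m E) c t u v ≡ vtxMatrix n m reduced u v
      combined u v = sym (trans (reduced-row (classify n m u) (classify n m v))
        (cong (E (classify n m u) (classify n m v) +_)
              (sumFin-cong (λ w → cong (λ a → c u w * E a (classify n m v)) (sym (classify-t u w))))))

mainTheorem12 : (n m : ℕ) (G : SignedGraph n) (H : SignedGraph m) (x : ℚ)
                (nz : charPoly H x ≢ 0ℚ) →
                charPoly (corona G H) x ≡ (charPoly H x ^ n) * charPoly G (x - coronal H x nz)
mainTheorem12 n m G H x nz = begin
  charPoly (corona G H) x                ≡⟨ det-cong idMinus-corona ⟩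
  det (vtxMatrix n m E)                  ≡⟨ det-reduced ⟩
  det (vtxMatrix n m reduced)
    ≡⟨ det-vtxMatrix-blockLowerTriangular n reduced T (λ _ _ → refl) (λ _ _ → refl) ⟩
  charPoly G (x - χ) * charPoly H x ^ n  ≡⟨ *-comm (charPoly G (x - χ)) (charPoly H x ^ n) ⟩
  charPoly H x ^ n * charPoly G (x - χ)  ∎
  where
  open ≡-Reasoning
  open CoronaCharacteristicMatrix G H x
  open Elimination nz
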